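{- For $w\in S_n$ with Rothe diagram $D(w)$, \begin{align*} r_1(D(w))+r_2(D(w))+r_3(D(w))\ \ge\ & p_{132}(w)+p_{1432}(w)+p_{13254}(w)+3p_{14253}(w)+p_{14352}(w)+4p_{15243}(w)\\ &+p_{15324}(w)+2p_{15342}(w)+p_{15432}(w)+p_{24153}(w)+2p_{25143}(w)+p_{35142}(w). \end{align*}
   Context: The Rothe diagram of $w\in S_n$ is $D(w)=\{(i,j)\in[n]\times[n]: j<w(i),\ i<w^{ -1}(j)\}$, where $(i,j)$ is the box in row $i$ (rows numbered top to bottom) and column $j$. For a diagram $D$: $r_1(D)$ is the number of pairs of boxes $\{(i_1,j),(i_2,j)\}$ with $i_1<i_2$, $(i_1,j)\notin D$, $(i_2,j)\in D$; $r_2(D)$ is the number of 6-box sets $\{i_1,i_2,i_3\}\times\{j_1,j_2\}$ with $i_1<i_2<i_3$, $j_1<j_2$ such that either exactly $(i_2,j_1),(i_2,j_2),(i_3,j_1)$ among them lie in $D$, or exactly $(i_2,j_1),(i_2,j_2),(i_3,j_2)$ among them lie in $D$; $r_3(D)$ is the number of 4-box sets $\{(i_1,a),(i_2,a),(i_3,b),(i_4,b)\}$ with $i_1<i_2<i_3<i_4$ (with $a<b$, $a>b$ or $a=b$) such that $(i_1,a),(i_3,b)\notin D$ and $(i_2,a),(i_4,b)\in D$. For $u\in S_m$, $p_u(w)$ is the number of subsequences $w(i_1)\cdots w(i_m)$, $i_1<\cdots<i_m$, having the same relative order as $u$. -}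

module Defs where

open import Data.Bool using (Bool; true; false; _∧_; _∨_; not; if_then_else_)
open import Data.Nat using (ℕ; zero; suc; _+_; _*_; _<ᵇ_)
open import Data.Nat.ListAction using (sum)
open import Data.List using (List; []; _∷_; map; allFin; _++_; length)
open import Data.Fin using (Fin; toℕ)
open import Data.Fin.Permutation using (Permutation′; _⟨$⟩ʳ_; _⟨$⟩ˡ_)

⟦_⟧ : Bool → ℕ
⟦ b ⟧ = if b then 1 else 0

∑ : (n : ℕ) → (Fin n → ℕ) → ℕ
∑ n f = sum (map f (allFin n))

_<F_ : {n : ℕ} → Fin n → Fin n → Bool
i <F j = toℕ i <ᵇ toℕ j

-- Rothe diagram of w ∈ S_n (S_n = Permutation′ n, on Fin n = {0,…,n-1}):
-- (i , j) ∈ D(w)  iff  j < w(i)  and  i < w⁻¹(j);  i = row, j = column.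
inD : {n : ℕ} → Permutation′ n → Fin n → Fin n → Bool
inD w i j = (j <F (w ⟨$⟩ʳ i)) ∧ (i <F (w ⟨$⟩ˡ j))

r₁ : {n : ℕ} → Permutation′ n → ℕ
r₁ {n} w =
  ∑ n λ j → ∑ n λ i₁ → ∑ n λ i₂ →
    ⟦ (i₁ <F i₂) ∧ not (inD w i₁ j) ∧ inD w i₂ j ⟧

r₂ : {n : ℕ} → Permutation′ n → ℕ
r₂ {n} w =
  ∑ n λ i₁ → ∑ n λ i₂ → ∑ n λ i₃ → ∑ n λ j₁ → ∑ n λ j₂ →
    ⟦ (i₁ <F i₂) ∧ (i₂ <F i₃) ∧ (j₁ <F j₂) ∧
      not (inD w i₁ j₁) ∧ not (inD w i₁ j₂) ∧
      inD w i₂ j₁ ∧ inD w i₂ j₂ ∧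
      ((inD w i₃ j₁ ∧ not (inD w i₃ j₂)) ∨ (not (inD w i₃ j₁) ∧ inD w i₃ j₂)) ⟧

-- r₃(D(w)): sets {(i₁,a),(i₂,a),(i₃,b),(i₄,b)}, i₁<i₂<i₃<i₄, a,b arbitrary,
-- with (i₁,a),(i₃,b) ∉ D and (i₂,a),(i₄,b) ∈ D.  (Since the four rows are
-- distinct, such a set determines the tuple (i₁,i₂,i₃,i₄,a,b).)
r₃ : {n : ℕ} → Permutation′ n → ℕ
r₃ {n} w =
  ∑ n λ i₁ → ∑ n λ i₂ → ∑ n λ i₃ → ∑ n λ i₄ → ∑ n λ a → ∑ n λ b →
    ⟦ (i₁ <F i₂) ∧ (i₂ <F i₃) ∧ (i₃ <F i₄) ∧
      not (inD w i₁ a) ∧ inD w i₂ a ∧ not (inD w i₃ b) ∧ inD w i₄ b ⟧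

choose : {A : Set} → ℕ → List A → List (List A)
choose zero    _        = [] ∷ []
choose (suc k) []       = []
choose (suc k) (x ∷ xs) = map (x ∷_) (choose k xs) ++ choose (suc k) xs

_≡ᵇB_ : Bool → Bool → Bool
true  ≡ᵇB b = b
false ≡ᵇB b = not b

sameHead : ℕ → ℕ → List ℕ → List ℕ → Bool
sameHead x y (x′ ∷ xs) (y′ ∷ ys) = ((x <ᵇ x′) ≡ᵇB (y <ᵇ y′)) ∧ sameHead x y xs ys
sameHead x y []        []        = true
sameHead x y _         _         = false

sameOrder : List ℕ → List ℕ → Bool
sameOrder []       []       = true
sameOrder (x ∷ xs) (y ∷ ys) = sameHead x y xs ys ∧ sameOrder xs ys
sameOrder _        _        = false

oneLine : {n : ℕ} → Permutation′ n → List ℕ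
oneLine {n} w = map (λ i → toℕ (w ⟨$⟩ʳ i)) (allFin n)

p : List ℕ → {n : ℕ} → Permutation′ n → ℕ
p u w = sum (map (λ s → ⟦ sameOrder u s ⟧) (choose (length u) (oneLine w)))

-- Name each column j of D(w) by the position q = w⁻¹(j) of its dot: then
-- (i, w(q)) ∈ D(w) iff i < q and w(q) < w(i), so r₁, r₂ and r₃ count tuples of
-- positions subject to comparisons between positions and between values.
-- Every occurrence of a pattern on the right is sent to configurations
-- counted on the left: a 132 to an r₁-pair, a 1432 to an r₂-configuration
-- whose row i₃ carries the dot of column j₂, and an occurrence of length five
-- to the r₂- and r₃-configurations that place their remaining rows and
-- columns at its positions in one of seven ways.  Different occurrences and
-- ways give different configurations, and what is left is an inequality
-- between functions of the ten comparisons among five values, checked over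
-- all 2¹⁰ Boolean vectors.

{-# OPTIONS --safe #-}
module Submission where

open import Defs
import Algebra.Properties.Semiring.Sum as SemiringSum
open import Data.Bool using (Bool; true; false; _∧_; _∨_; not; T)
open import Data.Bool.Properties using (T-∧; T-∨; T-not-≡)
open import Data.Empty using (⊥-elim)
open import Data.Fin using (Fin; zero; suc; toℕ) renaming (_<_ to _<ᶠ_; _≤_ to _≤ᶠ_)
open import Data.Fin.Permutation using (Permutation′; _⟨$⟩ʳ_; _⟨$⟩ˡ_; inverseˡ)
open import Data.Fin.Properties using (toℕ-injective)
open import Data.List using (List; []; _∷_; map; _++_; length; tabulate; allFin)
open import Data.List.Properties using (map-cong; map-tabulate; map-++; map-∘; length-++; length-map)
open import Data.Nat using (ℕ; zero; suc; _+_; _*_; _≤_; _<_; _≥_; _<ᵇ_; _≤ᵇ_; _≡ᵇ_; z≤n)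
open import Data.Nat.ListAction using (sum)
open import Data.Nat.ListAction.Properties using (sum-++)
open import Data.Nat.Properties
open import Algebra.Properties.CommutativeSemigroup *-commutativeSemigroup using (x∙yz≈y∙xz)
open import Data.Product using (_×_; _,_; proj₁; proj₂)
open import Data.Sum using (inj₁; inj₂)
open import Data.Unit using (tt)
open import Function using (_∘_; id)
open import Function.Bundles using (Equivalence)
open import Relation.Binary using (tri<; tri≈; tri>)
open import Relation.Binary.PropositionalEquality
open import Relation.Nullary using (¬_)

module VSum = SemiringSum +-*-semiring

_≐_ : ∀ {n} → Fin n → Fin n → Bool
i ≐ j = toℕ i ≡ᵇ toℕ j

infixr 4 _,ᵀ_

_,ᵀ_ : ∀ {a b} → T a → T b → T (a ∧ b)
ta ,ᵀ tb = Equivalence.from T-∧ (ta , tb)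

∧-elim : ∀ {a b} → T (a ∧ b) → T a × T b
∧-elim = Equivalence.to T-∧

T-not⇒¬T : ∀ {b} → T (not b) → ¬ T b
T-not⇒¬T t = subst T (Equivalence.to T-not-≡ t)

not-∧ˡ : ∀ {a b} → ¬ T a → T (not (a ∧ b))
not-∧ˡ {false} _  = tt
not-∧ˡ {true}  ¬a = ⊥-elim (¬a tt)

not-∧ʳ : ∀ {a b} → ¬ T b → T (not (a ∧ b))
not-∧ʳ {false}         _  = tt
not-∧ʳ {true}  {false} _  = tt
not-∧ʳ {true}  {true}  ¬b = ⊥-elim (¬b tt)

⟦⟧-true : ∀ {b} → T b → ⟦ b ⟧ ≡ 1
⟦⟧-true {true} _ = refl

⟦⟧-false : ∀ {b} → ¬ T b → ⟦ b ⟧ ≡ 0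
⟦⟧-false {false} _  = refl
⟦⟧-false {true}  ¬b = ⊥-elim (¬b tt)

⟦⟧-mono : ∀ {a b} → (T a → T b) → ⟦ a ⟧ ≤ ⟦ b ⟧
⟦⟧-mono {false}         _   = z≤n
⟦⟧-mono {true}  {true}  _   = ≤-refl
⟦⟧-mono {true}  {false} a⇒b = ⊥-elim (a⇒b tt)

⟦⟧*-≤ : ∀ {b x y} → (T b → x ≤ y) → ⟦ b ⟧ * x ≤ y
⟦⟧*-≤ {false} _       = z≤n
⟦⟧*-≤ {true}  {x} x≤y = subst (_≤ _) (sym (*-identityˡ x)) (x≤y tt)

⟦⟧*-mono : ∀ {b x y} → (T b → x ≤ y) → ⟦ b ⟧ * x ≤ ⟦ b ⟧ * y
⟦⟧*-mono {false} _   = z≤n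
⟦⟧*-mono {true}  x≤y = *-monoʳ-≤ 1 (x≤y tt)

exactly-one : Bool → Bool → Bool
exactly-one a b = (a ∧ not b) ∨ (not a ∧ b)

exactly-oneˡ : ∀ {a b} → T a → T (not b) → T (exactly-one a b)
exactly-oneˡ ta tb = Equivalence.from T-∨ (inj₁ (ta ,ᵀ tb))

exactly-oneʳ : ∀ {a b} → T (not a) → T b → T (exactly-one a b)
exactly-oneʳ ta tb = Equivalence.from T-∨ (inj₂ (ta ,ᵀ tb))

∧-elim₃ : ∀ {a b c} → T (a ∧ b ∧ c) → T a × T b × T c
∧-elim₃ t = let (ta , tbc) = ∧-elim t in ta , ∧-elim tbc

∧-elim₄ : ∀ {a b c d} → T (a ∧ b ∧ c ∧ d) → T a × T b × T c × T d
∧-elim₄ t = let (ta , tbcd) = ∧-elim t in ta , ∧-elim₃ tbcd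

T<F⇒<ᶠ : ∀ {n} {i j : Fin n} → T (i <F j) → i <ᶠ j
T<F⇒<ᶠ {i = i} {j} = <ᵇ⇒< (toℕ i) (toℕ j)

⟦<ᵇ⟧-exclusive : ∀ m n → ⟦ m <ᵇ n ⟧ + ⟦ n <ᵇ m ⟧ ≤ 1
⟦<ᵇ⟧-exclusive m n with m <ᵇ n in m<n | n <ᵇ m in n<m
... | false | false = z≤n
... | false | true  = ≤-refl
... | true  | false = ≤-refl
... | true  | true  =
  ⊥-elim (<-asym (<ᵇ⇒< m n (subst T (sym m<n) tt)) (<ᵇ⇒< n m (subst T (sym n<m) tt)))

≐⇒≡ : ∀ {n} (i j : Fin n) → (i ≐ j) ≡ true → i ≡ j
≐⇒≡ i j e = toℕ-injective (≡ᵇ⇒≡ (toℕ i) (toℕ j) (subst T (sym e) tt))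

⟦≐⟧-exclusive : ∀ {n} {x y z : Fin n} → x ≢ y → x ≢ z → y ≢ z →
                ∀ i → ⟦ i ≐ x ⟧ + ⟦ i ≐ y ⟧ + ⟦ i ≐ z ⟧ ≤ 1
⟦≐⟧-exclusive {x = x} {y} {z} x≢y x≢z y≢z i with i ≐ x in i≡x | i ≐ y in i≡y | i ≐ z in i≡z
... | true  | true  | _     = ⊥-elim (x≢y (trans (sym (≐⇒≡ i x i≡x)) (≐⇒≡ i y i≡y)))
... | true  | false | true  = ⊥-elim (x≢z (trans (sym (≐⇒≡ i x i≡x)) (≐⇒≡ i z i≡z)))
... | false | true  | true  = ⊥-elim (y≢z (trans (sym (≐⇒≡ i y i≡y)) (≐⇒≡ i z i≡z)))
... | true  | false | false = ≤-refl
... | false | true  | false = ≤-refl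
... | false | false | true  = ≤-refl
... | false | false | false = z≤n

∑≡sum : ∀ {n} (f : Fin n → ℕ) → ∑ n f ≡ VSum.sum f
∑≡sum f = trans (cong sum (map-tabulate id f)) (sum-tabulate f)
  where
  sum-tabulate : ∀ {n} (f : Fin n → ℕ) → sum (tabulate f) ≡ VSum.sum f
  sum-tabulate {zero}  f = refl
  sum-tabulate {suc n} f = cong (f zero +_) (sum-tabulate (f ∘ suc))

∑-cong : ∀ {n} {f g : Fin n → ℕ} → (∀ i → f i ≡ g i) → ∑ n f ≡ ∑ n g
∑-cong {n} f≗g = cong sum (map-cong f≗g (allFin n))

∑-suc : ∀ {n} (f : Fin (suc n) → ℕ) → ∑ (suc n) f ≡ f zero + ∑ n (f ∘ suc)
∑-suc f = trans (∑≡sum f) (cong (f zero +_) (sym (∑≡sum (f ∘ suc))))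

∑-mono : ∀ {n} {f g : Fin n → ℕ} → (∀ i → f i ≤ g i) → ∑ n f ≤ ∑ n g
∑-mono {f = f} {g} f≤g = subst₂ _≤_ (sym (∑≡sum f)) (sym (∑≡sum g)) (sum-mono f≤g)
  where
  sum-mono : ∀ {n} {f g : Fin n → ℕ} → (∀ i → f i ≤ g i) → VSum.sum f ≤ VSum.sum g
  sum-mono {zero}  _   = z≤n
  sum-mono {suc n} f≤g = +-mono-≤ (f≤g zero) (sum-mono (f≤g ∘ suc))

∑-distrib-+ : ∀ {n} (f g : Fin n → ℕ) → ∑ n (λ i → f i + g i) ≡ ∑ n f + ∑ n g
∑-distrib-+ f g =
  trans (∑≡sum (λ i → f i + g i)) (trans (VSum.∑-distrib-+ f g) (sym (cong₂ _+_ (∑≡sum f) (∑≡sum g))))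

∑-comm : ∀ {m n} (f : Fin m → Fin n → ℕ) →
         ∑ m (λ i → ∑ n (f i)) ≡ ∑ n (λ j → ∑ m (λ i → f i j))
∑-comm f = trans (∑²≡sum² f) (trans (VSum.∑-comm f) (sym (∑²≡sum² (λ j i → f i j))))
  where
  ∑²≡sum² : ∀ {m n} (f : Fin m → Fin n → ℕ) →
            ∑ m (λ i → ∑ n (f i)) ≡ VSum.sum (λ i → VSum.sum (f i))
  ∑²≡sum² f = trans (∑-cong (∑≡sum ∘ f)) (∑≡sum (λ i → VSum.sum (f i)))

∑-permute : ∀ {n} (f : Fin n → ℕ) (π : Permutation′ n) → ∑ n f ≡ ∑ n (λ i → f (π ⟨$⟩ʳ i))
∑-permute f π = trans (∑≡sum f) (trans (VSum.∑-permute f π) (sym (∑≡sum (λ i → f (π ⟨$⟩ʳ i)))))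

*-distribˡ-∑ : ∀ {n} c (f : Fin n → ℕ) → c * ∑ n f ≡ ∑ n (λ i → c * f i)
*-distribˡ-∑ c f =
  trans (cong (c *_) (∑≡sum f)) (trans (VSum.*-distribˡ-sum c f) (sym (∑≡sum (λ i → c * f i))))

∑-δ : ∀ {n} (x : Fin n) (f : Fin n → ℕ) → ∑ n (λ i → ⟦ i ≐ x ⟧ * f i) ≡ f x
∑-δ x f = trans (∑≡sum (λ i → ⟦ i ≐ x ⟧ * f i)) (sum-δ x f)
  where
  sum-δ : ∀ {n} (x : Fin n) (f : Fin n → ℕ) → VSum.sum (λ i → ⟦ i ≐ x ⟧ * f i) ≡ f x
  sum-δ {suc n} zero    f =
    trans (cong₂ _+_ (*-identityˡ (f zero)) (VSum.sum-replicate-zero n)) (+-identityʳ (f zero))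
  sum-δ {suc n} (suc x) f = sum-δ x (f ∘ suc)

∑²-distrib-+ : ∀ {m n} (f g : Fin m → Fin n → ℕ) →
  ∑ m (λ i → ∑ n λ j → f i j + g i j) ≡ ∑ m (λ i → ∑ n (f i)) + ∑ m (λ i → ∑ n (g i))
∑²-distrib-+ {n = n} f g =
  trans (∑-cong λ i → ∑-distrib-+ (f i) (g i)) (∑-distrib-+ (λ i → ∑ n (f i)) (λ i → ∑ n (g i)))

m≤1⇒m*n≤n : ∀ {m} n → m ≤ 1 → m * n ≤ n
m≤1⇒m*n≤n n m≤1 = ≤-trans (*-monoˡ-≤ n m≤1) (≤-reflexive (*-identityˡ n))

∑-guarded-+-≤ : ∀ {n} {b : Fin n → Bool} {f g h : Fin n → ℕ} →
  (∀ i → T (b i) → f i + g i ≤ h i) →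
  ∑ n (λ i → ⟦ b i ⟧ * f i) + ∑ n (λ i → ⟦ b i ⟧ * g i) ≤ ∑ n h
∑-guarded-+-≤ {n} {b} {f} {g} {h} bound = begin
  ∑ n (λ i → ⟦ b i ⟧ * f i) + ∑ n (λ i → ⟦ b i ⟧ * g i)
    ≡⟨ ∑-distrib-+ (λ i → ⟦ b i ⟧ * f i) _ ⟨
  ∑ n (λ i → ⟦ b i ⟧ * f i + ⟦ b i ⟧ * g i)
    ≡⟨ ∑-cong (λ i → *-distribˡ-+ ⟦ b i ⟧ (f i) (g i)) ⟨
  ∑ n (λ i → ⟦ b i ⟧ * (f i + g i))
    ≤⟨ ∑-mono (λ i → ⟦⟧*-≤ (bound i)) ⟩
  ∑ n h ∎
  where open ≤-Reasoning

∑-≥-three-points : ∀ {n} (f : Fin n → ℕ) {x y z : Fin n} → x ≢ y → x ≢ z → y ≢ z →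
                   f x + f y + f z ≤ ∑ n f
∑-≥-three-points {n} f {x} {y} {z} x≢y x≢z y≢z = begin
  f x + f y + f z
    ≡⟨ cong₂ _+_ (cong₂ _+_ (∑-δ x f) (∑-δ y f)) (∑-δ z f) ⟨
  ∑ n (δ x) + ∑ n (δ y) + ∑ n (δ z)
    ≡⟨ cong (_+ ∑ n (δ z)) (∑-distrib-+ (δ x) (δ y)) ⟨
  ∑ n (λ i → δ x i + δ y i) + ∑ n (δ z)
    ≡⟨ ∑-distrib-+ (λ i → δ x i + δ y i) (δ z) ⟨
  ∑ n (λ i → δ x i + δ y i + δ z i)
    ≤⟨ ∑-mono at-most-once ⟩
  ∑ n f ∎
  where
  open ≤-Reasoning
  δ : Fin n → Fin n → ℕ
  δ x i = ⟦ i ≐ x ⟧ * f i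
  at-most-once : ∀ i → δ x i + δ y i + δ z i ≤ f i
  at-most-once i = begin
    δ x i + δ y i + δ z i
      ≡⟨ trans (*-distribʳ-+ (f i) (⟦ i ≐ x ⟧ + ⟦ i ≐ y ⟧) _)
               (cong (_+ δ z i) (*-distribʳ-+ (f i) ⟦ i ≐ x ⟧ _)) ⟨
    (⟦ i ≐ x ⟧ + ⟦ i ≐ y ⟧ + ⟦ i ≐ z ⟧) * f i
      ≤⟨ m≤1⇒m*n≤n (f i) (⟦≐⟧-exclusive x≢y x≢z y≢z i) ⟩
    f i ∎

∑-pairs-≤ : ∀ {n} (h : Fin n → Fin n → ℕ) →
  ∑ n (λ y → ∑ n λ z → ⟦ y <F z ⟧ * (h y z + h z y)) ≤ ∑ n (λ y → ∑ n (h y))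
∑-pairs-≤ {n} h = begin
  ∑ n (λ y → ∑ n λ z → ⟦ y <F z ⟧ * (h y z + h z y))
    ≡⟨ ∑-cong (λ y → ∑-cong λ z → *-distribˡ-+ ⟦ y <F z ⟧ (h y z) (h z y)) ⟩
  ∑ n (λ y → ∑ n λ z → ⟦ y <F z ⟧ * h y z + ⟦ y <F z ⟧ * h z y)
    ≡⟨ ∑²-distrib-+ (λ y z → ⟦ y <F z ⟧ * h y z) (λ y z → ⟦ y <F z ⟧ * h z y) ⟩
  ∑ n (λ y → ∑ n λ z → ⟦ y <F z ⟧ * h y z) + ∑ n (λ y → ∑ n λ z → ⟦ y <F z ⟧ * h z y)
    ≡⟨ cong (∑ n (λ y → ∑ n λ z → ⟦ y <F z ⟧ * h y z) +_) (∑-comm (λ y z → ⟦ y <F z ⟧ * h z y)) ⟩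
  ∑ n (λ y → ∑ n λ z → ⟦ y <F z ⟧ * h y z) + ∑ n (λ y → ∑ n λ z → ⟦ z <F y ⟧ * h y z)
    ≡⟨ ∑²-distrib-+ (λ y z → ⟦ y <F z ⟧ * h y z) (λ y z → ⟦ z <F y ⟧ * h y z) ⟨
  ∑ n (λ y → ∑ n λ z → ⟦ y <F z ⟧ * h y z + ⟦ z <F y ⟧ * h y z)
    ≤⟨ ∑-mono (λ y → ∑-mono λ z → at-most-once y z) ⟩
  ∑ n (λ y → ∑ n (h y)) ∎
  where
  open ≤-Reasoning
  at-most-once : ∀ y z → ⟦ y <F z ⟧ * h y z + ⟦ z <F y ⟧ * h y z ≤ h y z
  at-most-once y z = subst (_≤ h y z) (*-distribʳ-+ (h y z) ⟦ y <F z ⟧ _)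
    (m≤1⇒m*n≤n (h y z) (⟦<ᵇ⟧-exclusive (toℕ y) (toℕ z)))

-- The five index regions z = x < y, x < y < z, x < z < y, y < x < z and
-- z < x < y are pairwise disjoint.
∑-ordered-triples-≤ : ∀ {n} (g : Fin n → Fin n → Fin n → ℕ) →
    ∑ n (λ a → ∑ n λ b → ⟦ a <F b ⟧ * g a b a)
  + (∑ n (λ a → ∑ n λ b → ⟦ a <F b ⟧ * ∑ n λ c → ⟦ b <F c ⟧ * (g a b c + g a c b))
  +  ∑ n (λ a → ∑ n λ b → ⟦ a <F b ⟧ * ∑ n λ c → ⟦ b <F c ⟧ * (g b a c + g b c a)))
  ≤ ∑ n (λ x → ∑ n λ y → ∑ n (g x y))
∑-ordered-triples-≤ {n} g = begin
  ∑ n E + (∑ n (λ a → ∑ n (I a)) + ∑ n (λ a → ∑ n λ b → M b a))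
     ≡⟨ cong (λ t → ∑ n E + (∑ n (λ a → ∑ n (I a)) + t)) (∑-comm (λ a b → M b a)) ⟩
  ∑ n E + (∑ n (λ x → ∑ n (I x)) + ∑ n (λ x → ∑ n (M x)))
     ≡⟨ cong (∑ n E +_) (∑-distrib-+ (λ x → ∑ n (I x)) (λ x → ∑ n (M x))) ⟨
  ∑ n E + ∑ n (λ x → ∑ n (I x) + ∑ n (M x))
     ≡⟨ ∑-distrib-+ E (λ x → ∑ n (I x) + ∑ n (M x)) ⟨
  ∑ n (λ x → E x + (∑ n (I x) + ∑ n (M x)))
     ≤⟨ ∑-mono slice ⟩
  ∑ n (λ x → ∑ n λ y → ∑ n (g x y)) ∎
  where
  open ≤-Reasoning
  S : Fin n → Fin n → Fin n → ℕ
  S x y z = g x y z + g x z y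
  E : Fin n → ℕ
  E x = ∑ n λ z → ⟦ x <F z ⟧ * g x z x
  I M : Fin n → Fin n → ℕ
  I x y = ⟦ x <F y ⟧ * ∑ n (λ z → ⟦ y <F z ⟧ * S x y z)
  M x y = ⟦ y <F x ⟧ * ∑ n (λ z → ⟦ x <F z ⟧ * S x y z)

  by-position : ∀ x y → ⟦ y ≐ x ⟧ * E x + (I x y + M x y) ≤ ∑ n (λ z → ⟦ y <F z ⟧ * S x y z)
  by-position x y with <-cmp (toℕ x) (toℕ y)
  ... | tri< x<y x≢y _
    rewrite ⟦⟧-false {y ≐ x} (x≢y ∘ sym ∘ ≡ᵇ⇒≡ (toℕ y) (toℕ x))
          | ⟦⟧-true {x <F y} (<⇒<ᵇ x<y)
          | ⟦⟧-false {y <F x} (<⇒≯ x<y ∘ <ᵇ⇒< (toℕ y) (toℕ x))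
    = ≤-reflexive (trans (+-identityʳ _) (+-identityʳ _))
  ... | tri≈ _ x≡y _
    rewrite toℕ-injective x≡y
          | ⟦⟧-true {y ≐ y} (≡⇒≡ᵇ (toℕ y) (toℕ y) refl)
          | ⟦⟧-false {y <F y} (<-irrefl refl ∘ <ᵇ⇒< (toℕ y) (toℕ y))
    = ≤-trans (≤-reflexive (trans (+-identityʳ _) (+-identityʳ _)))
              (∑-mono λ z → *-monoʳ-≤ ⟦ y <F z ⟧ (m≤n+m (g y z y) (g y y z)))
  ... | tri> _ x≢y y<x
    rewrite ⟦⟧-false {y ≐ x} (x≢y ∘ sym ∘ ≡ᵇ⇒≡ (toℕ y) (toℕ x))
          | ⟦⟧-false {x <F y} (<⇒≯ y<x ∘ <ᵇ⇒< (toℕ x) (toℕ y))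
          | ⟦⟧-true {y <F x} (<⇒<ᵇ y<x)
    = ≤-trans (≤-reflexive (+-identityʳ _))
              (∑-mono λ z → *-monoˡ-≤ (S x y z) (⟦⟧-mono (<⇒<ᵇ ∘ <-trans y<x ∘ <ᵇ⇒< (toℕ x) (toℕ z))))

  slice : ∀ x → E x + (∑ n (I x) + ∑ n (M x)) ≤ ∑ n (λ y → ∑ n (g x y))
  slice x = begin
    E x + (∑ n (I x) + ∑ n (M x))
      ≡⟨ cong₂ _+_ (∑-δ x (λ _ → E x)) (∑-distrib-+ (I x) (M x)) ⟨
    ∑ n (λ y → ⟦ y ≐ x ⟧ * E x) + ∑ n (λ y → I x y + M x y)
      ≡⟨ ∑-distrib-+ (λ y → ⟦ y ≐ x ⟧ * E x) (λ y → I x y + M x y) ⟨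
    ∑ n (λ y → ⟦ y ≐ x ⟧ * E x + (I x y + M x y))
      ≤⟨ ∑-mono (by-position x) ⟩
    ∑ n (λ y → ∑ n λ z → ⟦ y <F z ⟧ * S x y z)
      ≤⟨ ∑-pairs-≤ (g x) ⟩
    ∑ n (λ y → ∑ n (g x y)) ∎

-- Sums over increasing tuples

∑↑ : ∀ {n} → ℕ → ℕ → (Fin n → ℕ) → (List ℕ → ℕ) → ℕ
∑↑ {n} zero    lo g H = H []
∑↑ {n} (suc k) lo g H = ∑ n λ i → ⟦ lo ≤ᵇ toℕ i ⟧ * ∑↑ k (suc (toℕ i)) g (λ s → H (g i ∷ s))

∑↑-cong : ∀ {n} k lo (g : Fin n → ℕ) {F G : List ℕ → ℕ} →
          (∀ s → F s ≡ G s) → ∑↑ k lo g F ≡ ∑↑ k lo g G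
∑↑-cong zero    lo g F≗G = F≗G []
∑↑-cong (suc k) lo g F≗G =
  ∑-cong λ i → cong (⟦ lo ≤ᵇ toℕ i ⟧ *_) (∑↑-cong k (suc (toℕ i)) g (F≗G ∘ (g i ∷_)))

∑↑-mono : ∀ {n} k lo (g : Fin n → ℕ) {F G : List ℕ → ℕ} →
          (∀ s → length s ≡ k → F s ≤ G s) → ∑↑ k lo g F ≤ ∑↑ k lo g G
∑↑-mono zero    lo g F≤G = F≤G [] refl
∑↑-mono (suc k) lo g F≤G = ∑-mono λ i →
  *-monoʳ-≤ ⟦ lo ≤ᵇ toℕ i ⟧ (∑↑-mono k (suc (toℕ i)) g λ s len → F≤G (g i ∷ s) (cong suc len))

∑↑-+ : ∀ {n} k lo (g : Fin n → ℕ) (F G : List ℕ → ℕ) →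
       ∑↑ k lo g (λ s → F s + G s) ≡ ∑↑ k lo g F + ∑↑ k lo g G
∑↑-+ zero    lo g F G = refl
∑↑-+ {n} (suc k) lo g F G = trans
  (∑-cong {n} λ i → trans (cong (⟦ lo ≤ᵇ toℕ i ⟧ *_) (∑↑-+ k (suc (toℕ i)) g _ _))
                         (*-distribˡ-+ ⟦ lo ≤ᵇ toℕ i ⟧ _ _))
  (∑-distrib-+ (λ i → ⟦ lo ≤ᵇ toℕ i ⟧ * ∑↑ k (suc (toℕ i)) g (λ s → F (g i ∷ s)))
               (λ i → ⟦ lo ≤ᵇ toℕ i ⟧ * ∑↑ k (suc (toℕ i)) g (λ s → G (g i ∷ s))))

∑↑-* : ∀ {n} k lo (g : Fin n → ℕ) c (F : List ℕ → ℕ) →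
       ∑↑ k lo g (λ s → c * F s) ≡ c * ∑↑ k lo g F
∑↑-* zero    lo g c F = refl
∑↑-* {n} (suc k) lo g c F = trans
  (∑-cong {n} λ i → trans (cong (⟦ lo ≤ᵇ toℕ i ⟧ *_) (∑↑-* k (suc (toℕ i)) g c _))
                         (x∙yz≈y∙xz ⟦ lo ≤ᵇ toℕ i ⟧ c _))
  (sym (*-distribˡ-∑ c (λ i → ⟦ lo ≤ᵇ toℕ i ⟧ * ∑↑ k (suc (toℕ i)) g (λ s → F (g i ∷ s)))))

∑↑-zero : ∀ {n} k lo (g : Fin n → ℕ) → ∑↑ k lo g (λ _ → 0) ≡ 0
∑↑-zero k lo g = ∑↑-* k lo g 0 (λ _ → 0)

∑↑-shift : ∀ {n} k lo (g : Fin (suc n) → ℕ) H → ∑↑ k (suc lo) g H ≡ ∑↑ k lo (g ∘ suc) H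
∑↑-shift zero    lo g H = refl
∑↑-shift {n} (suc k) lo g H =
  trans (∑-suc (λ i → ⟦ suc lo ≤ᵇ toℕ i ⟧ * ∑↑ k (suc (toℕ i)) g (λ s → H (g i ∷ s))))
        (∑-cong {n} λ i → cong₂ _*_ (cong ⟦_⟧ (≤ᵇ-suc lo (toℕ i)))
                                    (∑↑-shift k (suc (toℕ i)) g (λ s → H (g (suc i) ∷ s))))
  where
  ≤ᵇ-suc : ∀ m n → (suc m ≤ᵇ suc n) ≡ (m ≤ᵇ n)
  ≤ᵇ-suc zero    n = refl
  ≤ᵇ-suc (suc m) n = refl

∑↑-choose : ∀ {n} k (g : Fin n → ℕ) H → ∑↑ k 0 g H ≡ sum (map H (choose k (tabulate g)))
∑↑-choose         zero    g H = sym (+-identityʳ (H []))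
∑↑-choose {zero}  (suc k) g H = refl
∑↑-choose {suc n} (suc k) g H = begin
  ∑↑ (suc k) 0 g H
    ≡⟨ ∑-suc (λ i → ⟦ 0 ≤ᵇ toℕ i ⟧ * ∑↑ k (suc (toℕ i)) g (λ s → H (g i ∷ s))) ⟩
  1 * ∑↑ k 1 g H₀ + ∑ n (λ i → 1 * ∑↑ k (2 + toℕ i) g (λ s → H (g (suc i) ∷ s)))
    ≡⟨ cong₂ _+_ (trans (*-identityˡ _) (∑↑-shift k 0 g H₀))
                 (∑-cong {n} λ i → cong (1 *_) (∑↑-shift k (suc (toℕ i)) g (λ s → H (g (suc i) ∷ s)))) ⟩
  ∑↑ k 0 (g ∘ suc) H₀ + ∑↑ (suc k) 0 (g ∘ suc) H
    ≡⟨ cong₂ _+_ (∑↑-choose k (g ∘ suc) H₀) (∑↑-choose (suc k) (g ∘ suc) H) ⟩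
  sum (map H₀ L₀) + sum (map H L₁)
    ≡⟨ cong (λ l → sum l + sum (map H L₁)) (map-∘ L₀) ⟩
  sum (map H (map (g zero ∷_) L₀)) + sum (map H L₁)
    ≡⟨ sum-++ (map H (map (g zero ∷_) L₀)) _ ⟨
  sum (map H (map (g zero ∷_) L₀) ++ map H L₁)
    ≡⟨ cong sum (map-++ H (map (g zero ∷_) L₀) L₁) ⟨
  sum (map H (choose (suc k) (tabulate g))) ∎
  where
  open ≡-Reasoning
  H₀ : List ℕ → ℕ
  H₀ s = H (g zero ∷ s)
  L₀ L₁ : List (List ℕ)
  L₀ = choose k (tabulate (g ∘ suc))
  L₁ = choose (suc k) (tabulate (g ∘ suc))

p≡∑↑ : ∀ u {n} (w : Permutation′ n) →
       p u w ≡ ∑↑ (length u) 0 (λ i → toℕ (w ⟨$⟩ʳ i)) (λ s → ⟦ sameOrder u s ⟧)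
p≡∑↑ u w = sym (trans (∑↑-choose (length u) (λ i → toℕ (w ⟨$⟩ʳ i)) (λ s → ⟦ sameOrder u s ⟧))
  (cong (λ l → sum (map (λ s → ⟦ sameOrder u s ⟧) (choose (length u) l))) (sym (map-tabulate id _))))

-- As `scale 1 x` is `x` on the nose, `weighted` unfolds to exactly the shape
-- of the right-hand side of theorem4p1.
scale : ℕ → ℕ → ℕ
scale 1 x = x
scale c x = c * x

scale-* : ∀ c x → scale c x ≡ c * x
scale-* 0             x = refl
scale-* 1             x = sym (*-identityˡ x)
scale-* (suc (suc c)) x = refl

weighted : ℕ → List (ℕ × List ℕ) → (List ℕ → ℕ) → ℕ
weighted acc []             P = acc
weighted acc ((c , u) ∷ cs) P = weighted (acc + scale c (P u)) cs P

weighted-mono : ∀ cs {a b} {P Q : List ℕ → ℕ} → a ≤ b → (∀ u → P u ≤ Q u) →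
                weighted a cs P ≤ weighted b cs Q
weighted-mono []             a≤b P≤Q = a≤b
weighted-mono ((c , u) ∷ cs) {P = P} {Q} a≤b P≤Q = weighted-mono cs (+-mono-≤ a≤b scaled) P≤Q
  where
  scaled : scale c (P u) ≤ scale c (Q u)
  scaled = subst₂ _≤_ (sym (scale-* c (P u))) (sym (scale-* c (Q u))) (*-monoʳ-≤ c (P≤Q u))

weighted-acc : ∀ a cs P → weighted a cs P ≡ a + weighted 0 cs P
weighted-acc a []             P = sym (+-identityʳ a)
weighted-acc a ((c , u) ∷ cs) P = begin
  weighted (a + scale c (P u)) cs P      ≡⟨ weighted-acc (a + scale c (P u)) cs P ⟩
  a + scale c (P u) + weighted 0 cs P    ≡⟨ +-assoc a _ _ ⟩
  a + (scale c (P u) + weighted 0 cs P)  ≡⟨ cong (a +_) (weighted-acc (scale c (P u)) cs P) ⟨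
  a + weighted (scale c (P u)) cs P      ∎
  where open ≡-Reasoning

∑↑-weighted : ∀ {n} k lo (g : Fin n → ℕ) cs (H : List ℕ → List ℕ → ℕ) →
  weighted 0 cs (λ u → ∑↑ k lo g (H u)) ≡ ∑↑ k lo g (λ s → weighted 0 cs (λ u → H u s))
∑↑-weighted k lo g cs H =
  trans (cong (λ a → weighted a cs (λ u → ∑↑ k lo g (H u))) (sym (∑↑-zero k lo g)))
        (linear cs (λ _ → 0))
  where
  linear : ∀ cs F → weighted (∑↑ k lo g F) cs (λ u → ∑↑ k lo g (H u))
                  ≡ ∑↑ k lo g (λ s → weighted (F s) cs (λ u → H u s))
  linear []             F = refl
  linear ((c , u) ∷ cs) F =
    trans (cong (λ a → weighted a cs (λ u → ∑↑ k lo g (H u))) (sym split)) (linear cs F′)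
    where
    F′ : List ℕ → ℕ
    F′ s = F s + scale c (H u s)
    split : ∑↑ k lo g F′ ≡ ∑↑ k lo g F + scale c (∑↑ k lo g (H u))
    split = begin
      ∑↑ k lo g F′                                   ≡⟨ ∑↑-+ k lo g F _ ⟩
      ∑↑ k lo g F + ∑↑ k lo g (λ s → scale c (H u s)) ≡⟨ cong (∑↑ k lo g F +_) scaled ⟩
      ∑↑ k lo g F + scale c (∑↑ k lo g (H u))         ∎
      where
      open ≡-Reasoning
      scaled : ∑↑ k lo g (λ s → scale c (H u s)) ≡ scale c (∑↑ k lo g (H u))
      scaled = trans (∑↑-cong k lo g (λ s → scale-* c (H u s)))
                     (trans (∑↑-* k lo g c (H u)) (sym (scale-* c _)))

-- Comparison vectors and shapes

comparisons : List ℕ → List Bool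
comparisons []       = []
comparisons (x ∷ xs) = map (x <ᵇ_) xs ++ comparisons xs

pairs : ℕ → ℕ
pairs zero    = 0
pairs (suc k) = k + pairs k

length-comparisons : ∀ s → length (comparisons s) ≡ pairs (length s)
length-comparisons []       = refl
length-comparisons (x ∷ xs) = trans (length-++ (map (x <ᵇ_) xs))
  (cong₂ _+_ (length-map (x <ᵇ_) xs) (length-comparisons xs))

agree : List Bool → List Bool → Bool
agree []       []       = true
agree (a ∷ as) (b ∷ bs) = (a ≡ᵇB b) ∧ agree as bs
agree _        _        = false

agree-++ : ∀ as bs {cs ds} → T (agree as bs) → T (agree cs ds) → T (agree (as ++ cs) (bs ++ ds))
agree-++ []       []       _ t = t
agree-++ (a ∷ as) (b ∷ bs) t t′ = let (a≡b , rest) = ∧-elim t in a≡b ,ᵀ agree-++ as bs rest t′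

sameHead≡agree : ∀ x y xs ys → sameHead x y xs ys ≡ agree (map (x <ᵇ_) xs) (map (y <ᵇ_) ys)
sameHead≡agree x y []        []        = refl
sameHead≡agree x y []        (_ ∷ _)   = refl
sameHead≡agree x y (_ ∷ _)   []        = refl
sameHead≡agree x y (x′ ∷ xs) (y′ ∷ ys) =
  cong (((x <ᵇ x′) ≡ᵇB (y <ᵇ y′)) ∧_) (sameHead≡agree x y xs ys)

sameOrder⇒agree : ∀ u s → T (sameOrder u s) → T (agree (comparisons u) (comparisons s))
sameOrder⇒agree []       []       _ = tt
sameOrder⇒agree (x ∷ xs) (y ∷ ys) t =
  let (heads , rest) = ∧-elim t
  in agree-++ (map (x <ᵇ_) xs) (map (y <ᵇ_) ys)
              (subst T (sameHead≡agree x y xs ys) heads) (sameOrder⇒agree xs ys rest)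

forallBits : ℕ → (List Bool → Bool) → Bool
forallBits zero    P = P []
forallBits (suc k) P = forallBits k (P ∘ (true ∷_)) ∧ forallBits k (P ∘ (false ∷_))

forallBits-sound : ∀ k P → T (forallBits k P) → ∀ bs → length bs ≡ k → T (P bs)
forallBits-sound zero    P t []           refl = t
forallBits-sound (suc k) P t (true  ∷ bs) refl = forallBits-sound k _ (proj₁ (∧-elim t)) bs refl
forallBits-sound (suc k) P t (false ∷ bs) refl = forallBits-sound k _ (proj₂ (∧-elim t)) bs refl

-- Order patterns and shapes see a tuple only through its comparison vector, so
-- an inequality between them can be decided by running over all Boolean
-- vectors, consistent or not.
counts-≤-shapes : ∀ {n} k (g : Fin n → ℕ) cs (G : List Bool → ℕ) →
  T (forallBits (pairs k) (λ bs → weighted 0 cs (λ u → ⟦ agree (comparisons u) bs ⟧) ≤ᵇ G bs)) →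
  ∑↑ k 0 g (λ s → weighted 0 cs (λ u → ⟦ sameOrder u s ⟧)) ≤ ∑↑ k 0 g (G ∘ comparisons)
counts-≤-shapes k g cs G check = ∑↑-mono k 0 g λ s len → ≤-trans
  (weighted-mono cs ≤-refl (λ u → ⟦⟧-mono (sameOrder⇒agree u s)))
  (≤ᵇ⇒≤ _ _ (forallBits-sound (pairs k) _ check (comparisons s)
                              (trans (length-comparisons s) (cong pairs len))))

-- A shape is a condition on the comparison vector of the values x₁ … xₖ of w
-- at positions p₁ < ⋯ < pₖ under which these positions carry an r₁-, r₂- or
-- r₃-configuration: p₁ and p₂ are its rows i₁ and i₂, and the other positions
-- play the roles in brackets, a column being named by the position of its dot
-- (q for r₁; q₁, q₂ for the columns j₁ < j₂ of r₂; qa, qb for the columns a, b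
-- of r₃, with qb = p₅).  `inside (x <ᵇ y) (z <ᵇ y)` says that y lies in the
-- value window (x, z].
inside : Bool → Bool → Bool
inside lo<y hi<y = lo<y ∧ not hi<y

r₁-shape : List Bool → Bool
r₁-shape (_ ∷ x₁<x₃ ∷ x₂<x₃ ∷ []) = inside x₁<x₃ x₂<x₃
r₁-shape _                        = false

r₂-shape[i₃q₁] : List Bool → Bool
r₂-shape[i₃q₁] (_ ∷ x₁<x₃ ∷ x₁<x₄ ∷ x₂<x₃ ∷ x₂<x₄ ∷ x₃<x₄ ∷ []) =
  inside x₁<x₃ x₂<x₃ ∧ inside x₁<x₄ x₂<x₄ ∧ not x₃<x₄
r₂-shape[i₃q₁] _ = false

r₂-shape[i₃q₁q₂] r₂-shape[i₃q₂q₁] r₂-shape[q₁i₃q₂] r₂-shape[q₂i₃q₁] : List Bool → Bool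
r₂-shape[i₃q₁q₂] (_ ∷ _ ∷ x₁<x₄ ∷ x₁<x₅ ∷ _ ∷ x₂<x₄ ∷ x₂<x₅ ∷ x₃<x₄ ∷ x₃<x₅ ∷ _ ∷ []) =
  inside x₁<x₄ x₂<x₄ ∧ inside x₁<x₅ x₂<x₅ ∧ not x₃<x₄ ∧ x₃<x₅
r₂-shape[i₃q₁q₂] _ = false
r₂-shape[i₃q₂q₁] (_ ∷ _ ∷ x₁<x₄ ∷ x₁<x₅ ∷ _ ∷ x₂<x₄ ∷ x₂<x₅ ∷ x₃<x₄ ∷ x₃<x₅ ∷ _ ∷ []) =
  inside x₁<x₄ x₂<x₄ ∧ inside x₁<x₅ x₂<x₅ ∧ x₃<x₄ ∧ not x₃<x₅
r₂-shape[i₃q₂q₁] _ = false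
r₂-shape[q₁i₃q₂] (_ ∷ x₁<x₃ ∷ _ ∷ x₁<x₅ ∷ x₂<x₃ ∷ _ ∷ x₂<x₅ ∷ _ ∷ x₃<x₅ ∷ x₄<x₅ ∷ []) =
  inside x₁<x₃ x₂<x₃ ∧ inside x₁<x₅ x₂<x₅ ∧ x₃<x₅ ∧ not x₄<x₅
r₂-shape[q₁i₃q₂] _ = false
r₂-shape[q₂i₃q₁] (_ ∷ x₁<x₃ ∷ _ ∷ x₁<x₅ ∷ x₂<x₃ ∷ _ ∷ x₂<x₅ ∷ _ ∷ x₃<x₅ ∷ x₄<x₅ ∷ []) =
  inside x₁<x₃ x₂<x₃ ∧ inside x₁<x₅ x₂<x₅ ∧ not x₃<x₅ ∧ not x₄<x₅
r₂-shape[q₂i₃q₁] _ = false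

r₃-shape[qa=i₃] r₃-shape[qa=i₄] r₃-shape[qa=qb] : List Bool → Bool
r₃-shape[qa=i₃] (_ ∷ x₁<x₃ ∷ _ ∷ _ ∷ x₂<x₃ ∷ _ ∷ _ ∷ _ ∷ x₃<x₅ ∷ x₄<x₅ ∷ []) =
  inside x₁<x₃ x₂<x₃ ∧ inside x₃<x₅ x₄<x₅
r₃-shape[qa=i₃] _ = false
r₃-shape[qa=i₄] (_ ∷ _ ∷ x₁<x₄ ∷ _ ∷ _ ∷ x₂<x₄ ∷ _ ∷ _ ∷ x₃<x₅ ∷ x₄<x₅ ∷ []) =
  inside x₁<x₄ x₂<x₄ ∧ inside x₃<x₅ x₄<x₅
r₃-shape[qa=i₄] _ = false
r₃-shape[qa=qb] (_ ∷ _ ∷ _ ∷ x₁<x₅ ∷ _ ∷ _ ∷ x₂<x₅ ∷ _ ∷ x₃<x₅ ∷ x₄<x₅ ∷ []) =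
  inside x₁<x₅ x₂<x₅ ∧ inside x₃<x₅ x₄<x₅
r₃-shape[qa=qb] _ = false

r₂-shapes r₃-shapes : List Bool → ℕ
r₂-shapes bs = (⟦ r₂-shape[i₃q₁q₂] bs ⟧ + ⟦ r₂-shape[i₃q₂q₁] bs ⟧)
             + (⟦ r₂-shape[q₁i₃q₂] bs ⟧ + ⟦ r₂-shape[q₂i₃q₁] bs ⟧)
r₃-shapes bs = ⟦ r₃-shape[qa=i₃] bs ⟧ + ⟦ r₃-shape[qa=i₄] bs ⟧ + ⟦ r₃-shape[qa=qb] bs ⟧

patterns₅ : List (ℕ × List ℕ)
patterns₅ = (1 , 1 ∷ 3 ∷ 2 ∷ 5 ∷ 4 ∷ []) ∷ (3 , 1 ∷ 4 ∷ 2 ∷ 5 ∷ 3 ∷ [])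
          ∷ (1 , 1 ∷ 4 ∷ 3 ∷ 5 ∷ 2 ∷ []) ∷ (4 , 1 ∷ 5 ∷ 2 ∷ 4 ∷ 3 ∷ [])
          ∷ (1 , 1 ∷ 5 ∷ 3 ∷ 2 ∷ 4 ∷ []) ∷ (2 , 1 ∷ 5 ∷ 3 ∷ 4 ∷ 2 ∷ [])
          ∷ (1 , 1 ∷ 5 ∷ 4 ∷ 3 ∷ 2 ∷ []) ∷ (1 , 2 ∷ 4 ∷ 1 ∷ 5 ∷ 3 ∷ [])
          ∷ (2 , 2 ∷ 5 ∷ 1 ∷ 4 ∷ 3 ∷ []) ∷ (1 , 3 ∷ 5 ∷ 1 ∷ 4 ∷ 2 ∷ []) ∷ []

-- Rothe diagrams

module Rothe {n : ℕ} (w : Permutation′ n) where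

  v : Fin n → ℕ
  v i = toℕ (w ⟨$⟩ʳ i)

  R₁ : Fin n → Fin n → Fin n → Bool
  R₁ j i₁ i₂ = (i₁ <F i₂) ∧ not (inD w i₁ j) ∧ inD w i₂ j

  R₂ : Fin n → Fin n → Fin n → Fin n → Fin n → Bool
  R₂ i₁ i₂ i₃ j₁ j₂ = (i₁ <F i₂) ∧ (i₂ <F i₃) ∧ (j₁ <F j₂) ∧
    not (inD w i₁ j₁) ∧ not (inD w i₁ j₂) ∧ inD w i₂ j₁ ∧ inD w i₂ j₂ ∧
    exactly-one (inD w i₃ j₁) (inD w i₃ j₂)

  R₃ : Fin n → Fin n → Fin n → Fin n → Fin n → Fin n → Bool
  R₃ i₁ i₂ i₃ i₄ a b = (i₁ <F i₂) ∧ (i₂ <F i₃) ∧ (i₃ <F i₄) ∧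
    not (inD w i₁ a) ∧ inD w i₂ a ∧ not (inD w i₃ b) ∧ inD w i₄ b

  w-injective : ∀ {i j} → w ⟨$⟩ʳ i ≡ w ⟨$⟩ʳ j → i ≡ j
  w-injective e = trans (sym (inverseˡ w)) (trans (cong (w ⟨$⟩ˡ_) e) (inverseˡ w))

  w-≢ : ∀ {i j} → i <ᶠ j → w ⟨$⟩ʳ i ≢ w ⟨$⟩ʳ j
  w-≢ i<j = <⇒≢ i<j ∘ cong toℕ ∘ w-injective

  v-flip : ∀ {i j} → i <ᶠ j → T (not (v i <ᵇ v j)) → v j < v i
  v-flip i<j vi≮vj = ≤∧≢⇒< (≮⇒≥ (T-not⇒¬T vi≮vj ∘ <⇒<ᵇ)) (w-≢ i<j ∘ sym ∘ toℕ-injective)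

  inD-at : ∀ i q → inD w i (w ⟨$⟩ʳ q) ≡ (v q <ᵇ v i) ∧ (i <F q)
  inD-at i q = cong (λ j → (v q <ᵇ v i) ∧ (i <F j)) (inverseˡ w)

  ∈D : ∀ {i q} → i <ᶠ q → v q < v i → T (inD w i (w ⟨$⟩ʳ q))
  ∈D {i} {q} i<q vq<vi = subst T (sym (inD-at i q)) (<⇒<ᵇ vq<vi ,ᵀ <⇒<ᵇ i<q)

  ∉D-right : ∀ {i q} → v i < v q → T (not (inD w i (w ⟨$⟩ʳ q)))
  ∉D-right {i} {q} vi<vq =
    subst (T ∘ not) (sym (inD-at i q)) (not-∧ˡ (<⇒≯ vi<vq ∘ <ᵇ⇒< (v q) (v i)))

  ∉D-below : ∀ {i q} → q ≤ᶠ i → T (not (inD w i (w ⟨$⟩ʳ q)))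
  ∉D-below {i} {q} q≤i =
    subst (T ∘ not) (sym (inD-at i q)) (not-∧ʳ (≤⇒≯ q≤i ∘ <ᵇ⇒< (toℕ i) (toℕ q)))

  window : ∀ {i i′ q} → i′ <ᶠ q → T (inside (v i <ᵇ v q) (v i′ <ᵇ v q)) →
           T (not (inD w i (w ⟨$⟩ʳ q))) × T (inD w i′ (w ⟨$⟩ʳ q))
  window {i} {q = q} i′<q t =
    let (vi<vq , vi′≮vq) = ∧-elim t
    in ∉D-right (<ᵇ⇒< (v i) (v q) vi<vq) , ∈D i′<q (v-flip i′<q vi′≮vq)

  R₁-intro : ∀ i₁ i₂ q → i₁ <ᶠ i₂ → i₂ <ᶠ q → T (inside (v i₁ <ᵇ v q) (v i₂ <ᵇ v q)) →
             T (R₁ (w ⟨$⟩ʳ q) i₁ i₂)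
  R₁-intro i₁ i₂ q i₁<i₂ i₂<q t = let (∉₁ , ∈₂) = window i₂<q t in <⇒<ᵇ i₁<i₂ ,ᵀ ∉₁ ,ᵀ ∈₂

  r₁-bound : ∑↑ 3 0 v (⟦_⟧ ∘ r₁-shape ∘ comparisons) ≤ r₁ w
  r₁-bound = begin
    ∑↑ 3 0 v (⟦_⟧ ∘ r₁-shape ∘ comparisons)
      ≤⟨ (∑-mono λ i₁ → ⟦⟧*-≤ λ _ → ∑-mono λ i₂ → ⟦⟧*-≤ λ i₁<i₂ → ∑-mono λ q → ⟦⟧*-≤ λ i₂<q →
          ⟦⟧-mono (R₁-intro i₁ i₂ q (T<F⇒<ᶠ i₁<i₂) (T<F⇒<ᶠ i₂<q))) ⟩
    ∑ n (λ i₁ → ∑ n λ i₂ → ∑ n λ q → ⟦ R₁ (w ⟨$⟩ʳ q) i₁ i₂ ⟧)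
      ≡⟨ ∑-cong (λ i₁ → ∑-comm (λ q i₂ → ⟦ R₁ (w ⟨$⟩ʳ q) i₁ i₂ ⟧)) ⟨
    ∑ n (λ i₁ → ∑ n λ q → ∑ n λ i₂ → ⟦ R₁ (w ⟨$⟩ʳ q) i₁ i₂ ⟧)
      ≡⟨ ∑-comm (λ q i₁ → ∑ n λ i₂ → ⟦ R₁ (w ⟨$⟩ʳ q) i₁ i₂ ⟧) ⟨
    ∑ n (λ q → ∑ n λ i₁ → ∑ n λ i₂ → ⟦ R₁ (w ⟨$⟩ʳ q) i₁ i₂ ⟧)
      ≡⟨ ∑-permute (λ j → ∑ n λ i₁ → ∑ n λ i₂ → ⟦ R₁ j i₁ i₂ ⟧) w ⟨
    r₁ w ∎
    where open ≤-Reasoning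

  R₃-intro : ∀ i₁ i₂ i₃ i₄ qa qb → i₁ <ᶠ i₂ → i₂ <ᶠ i₃ → i₃ <ᶠ i₄ → i₂ <ᶠ qa → i₄ <ᶠ qb →
    T (inside (v i₁ <ᵇ v qa) (v i₂ <ᵇ v qa)) × T (inside (v i₃ <ᵇ v qb) (v i₄ <ᵇ v qb)) →
    T (R₃ i₁ i₂ i₃ i₄ (w ⟨$⟩ʳ qa) (w ⟨$⟩ʳ qb))
  R₃-intro _ _ _ _ _ _ i₁<i₂ i₂<i₃ i₃<i₄ i₂<qa i₄<qb (ta , tb) =
    let (∉a , ∈a) = window i₂<qa ta
        (∉b , ∈b) = window i₄<qb tb
    in <⇒<ᵇ i₁<i₂ ,ᵀ <⇒<ᵇ i₂<i₃ ,ᵀ <⇒<ᵇ i₃<i₄ ,ᵀ ∉a ,ᵀ ∈a ,ᵀ ∉b ,ᵀ ∈b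

  r₃-at-rows : ∀ i₁ i₂ i₃ i₄ → i₁ <ᶠ i₂ → i₂ <ᶠ i₃ → i₃ <ᶠ i₄ →
    ∑ n (λ q → ⟦ i₄ <F q ⟧ * r₃-shapes (comparisons (v i₁ ∷ v i₂ ∷ v i₃ ∷ v i₄ ∷ v q ∷ [])))
    ≤ ∑ n (λ a → ∑ n λ b → ⟦ R₃ i₁ i₂ i₃ i₄ a b ⟧)
  r₃-at-rows i₁ i₂ i₃ i₄ i₁<i₂ i₂<i₃ i₃<i₄ = begin
    ∑ n (λ q → ⟦ i₄ <F q ⟧ * r₃-shapes (comparisons (v i₁ ∷ v i₂ ∷ v i₃ ∷ v i₄ ∷ v q ∷ [])))
      ≤⟨ ∑-mono (λ q → ⟦⟧*-≤ (three-columns q ∘ T<F⇒<ᶠ)) ⟩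
    ∑ n (λ q → ∑ n λ a → ⟦ R₃ i₁ i₂ i₃ i₄ a (w ⟨$⟩ʳ q) ⟧)
      ≡⟨ ∑-permute (λ b → ∑ n λ a → ⟦ R₃ i₁ i₂ i₃ i₄ a b ⟧) w ⟨
    ∑ n (λ b → ∑ n λ a → ⟦ R₃ i₁ i₂ i₃ i₄ a b ⟧)
      ≡⟨ ∑-comm (λ a b → ⟦ R₃ i₁ i₂ i₃ i₄ a b ⟧) ⟨
    ∑ n (λ a → ∑ n λ b → ⟦ R₃ i₁ i₂ i₃ i₄ a b ⟧) ∎
    where
    open ≤-Reasoning
    three-columns : ∀ q → i₄ <ᶠ q →
      r₃-shapes (comparisons (v i₁ ∷ v i₂ ∷ v i₃ ∷ v i₄ ∷ v q ∷ []))
      ≤ ∑ n λ a → ⟦ R₃ i₁ i₂ i₃ i₄ a (w ⟨$⟩ʳ q) ⟧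
    three-columns q i₄<q = ≤-trans
      (+-mono-≤ (+-mono-≤ (⟦⟧-mono (R₃-intro i₁ i₂ i₃ i₄ i₃ q i₁<i₂ i₂<i₃ i₃<i₄ i₂<i₃ i₄<q ∘ ∧-elim))
                          (⟦⟧-mono (R₃-intro i₁ i₂ i₃ i₄ i₄ q i₁<i₂ i₂<i₃ i₃<i₄ i₂<i₄ i₄<q ∘ ∧-elim)))
                (⟦⟧-mono (R₃-intro i₁ i₂ i₃ i₄ q q i₁<i₂ i₂<i₃ i₃<i₄ i₂<q i₄<q ∘ ∧-elim)))
      (∑-≥-three-points (λ a → ⟦ R₃ i₁ i₂ i₃ i₄ a (w ⟨$⟩ʳ q) ⟧) (w-≢ i₃<i₄) (w-≢ i₃<q) (w-≢ i₄<q))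
      where
      i₂<i₄ : i₂ <ᶠ i₄
      i₂<i₄ = <-trans i₂<i₃ i₃<i₄
      i₃<q : i₃ <ᶠ q
      i₃<q = <-trans i₃<i₄ i₄<q
      i₂<q : i₂ <ᶠ q
      i₂<q = <-trans i₂<i₄ i₄<q

  r₃-bound : ∑↑ 5 0 v (r₃-shapes ∘ comparisons) ≤ r₃ w
  r₃-bound =
    ∑-mono λ i₁ → ⟦⟧*-≤ λ _ → ∑-mono λ i₂ → ⟦⟧*-≤ λ i₁<i₂ → ∑-mono λ i₃ → ⟦⟧*-≤ λ i₂<i₃ →
    ∑-mono λ i₄ → ⟦⟧*-≤ λ i₃<i₄ →
    r₃-at-rows i₁ i₂ i₃ i₄ (T<F⇒<ᶠ i₁<i₂) (T<F⇒<ᶠ i₂<i₃) (T<F⇒<ᶠ i₃<i₄)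

  R₂-intro : ∀ i₁ i₂ i₃ q₁ q₂ → i₁ <ᶠ i₂ → i₂ <ᶠ i₃ → i₂ <ᶠ q₁ → i₂ <ᶠ q₂ →
    T (inside (v i₁ <ᵇ v q₁) (v i₂ <ᵇ v q₁)) → T (inside (v i₁ <ᵇ v q₂) (v i₂ <ᵇ v q₂)) →
    v q₁ < v q₂ → T (exactly-one (inD w i₃ (w ⟨$⟩ʳ q₁)) (inD w i₃ (w ⟨$⟩ʳ q₂))) →
    T (R₂ i₁ i₂ i₃ (w ⟨$⟩ʳ q₁) (w ⟨$⟩ʳ q₂))
  R₂-intro _ _ _ _ _ i₁<i₂ i₂<i₃ i₂<q₁ i₂<q₂ t₁ t₂ v₁<v₂ row₃ =
    let (∉₁ , ∈₁) = window i₂<q₁ t₁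
        (∉₂ , ∈₂) = window i₂<q₂ t₂
    in <⇒<ᵇ i₁<i₂ ,ᵀ <⇒<ᵇ i₂<i₃ ,ᵀ <⇒<ᵇ v₁<v₂ ,ᵀ ∉₁ ,ᵀ ∉₂ ,ᵀ ∈₁ ,ᵀ ∈₂ ,ᵀ row₃

  R₂-i₃q₁ : ∀ i₁ i₂ a b → i₁ <ᶠ i₂ → i₂ <ᶠ a → a <ᶠ b →
    T (r₂-shape[i₃q₁] (comparisons (v i₁ ∷ v i₂ ∷ v a ∷ v b ∷ []))) →
    T (R₂ i₁ i₂ a (w ⟨$⟩ʳ b) (w ⟨$⟩ʳ a))
  R₂-i₃q₁ i₁ i₂ a b i₁<i₂ i₂<a a<b t =
    let (ta , tb , va≮vb) = ∧-elim₃ t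
        vb<va = v-flip a<b va≮vb
    in R₂-intro i₁ i₂ a b a i₁<i₂ i₂<a (<-trans i₂<a a<b) i₂<a tb ta vb<va
         (exactly-oneˡ (∈D a<b vb<va) (∉D-below ≤-refl))

  module FivePositions (i₁ i₂ a b c : Fin n)
    (i₁<i₂ : i₁ <ᶠ i₂) (i₂<a : i₂ <ᶠ a) (a<b : a <ᶠ b) (b<c : b <ᶠ c) where

    private
      i₂<b : i₂ <ᶠ b
      i₂<b = <-trans i₂<a a<b
      i₂<c : i₂ <ᶠ c
      i₂<c = <-trans i₂<b b<c
      a<c : a <ᶠ c
      a<c = <-trans a<b b<c
      vs : List ℕ
      vs = v i₁ ∷ v i₂ ∷ v a ∷ v b ∷ v c ∷ []

    R₂-i₃q₁q₂ : T (r₂-shape[i₃q₁q₂] (comparisons vs)) → T (R₂ i₁ i₂ a (w ⟨$⟩ʳ b) (w ⟨$⟩ʳ c))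
    R₂-i₃q₁q₂ t =
      let (tb , tc , va≮vb , va<ᵇvc) = ∧-elim₄ t
          vb<va = v-flip a<b va≮vb
          va<vc = <ᵇ⇒< (v a) (v c) va<ᵇvc
      in R₂-intro i₁ i₂ a b c i₁<i₂ i₂<a i₂<b i₂<c tb tc (<-trans vb<va va<vc)
           (exactly-oneˡ (∈D a<b vb<va) (∉D-right va<vc))

    R₂-i₃q₂q₁ : T (r₂-shape[i₃q₂q₁] (comparisons vs)) → T (R₂ i₁ i₂ a (w ⟨$⟩ʳ c) (w ⟨$⟩ʳ b))
    R₂-i₃q₂q₁ t =
      let (tb , tc , va<ᵇvb , va≮vc) = ∧-elim₄ t
          vc<va = v-flip a<c va≮vc
          va<vb = <ᵇ⇒< (v a) (v b) va<ᵇvb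
      in R₂-intro i₁ i₂ a c b i₁<i₂ i₂<a i₂<c i₂<b tc tb (<-trans vc<va va<vb)
           (exactly-oneˡ (∈D a<c vc<va) (∉D-right va<vb))

    R₂-q₁i₃q₂ : T (r₂-shape[q₁i₃q₂] (comparisons vs)) → T (R₂ i₁ i₂ b (w ⟨$⟩ʳ a) (w ⟨$⟩ʳ c))
    R₂-q₁i₃q₂ t =
      let (ta , tc , va<ᵇvc , vb≮vc) = ∧-elim₄ t
      in R₂-intro i₁ i₂ b a c i₁<i₂ i₂<b i₂<a i₂<c ta tc (<ᵇ⇒< (v a) (v c) va<ᵇvc)
           (exactly-oneʳ (∉D-below (<⇒≤ a<b)) (∈D b<c (v-flip b<c vb≮vc)))

    R₂-q₂i₃q₁ : T (r₂-shape[q₂i₃q₁] (comparisons vs)) → T (R₂ i₁ i₂ b (w ⟨$⟩ʳ c) (w ⟨$⟩ʳ a))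
    R₂-q₂i₃q₁ t =
      let (ta , tc , va≮vc , vb≮vc) = ∧-elim₄ t
      in R₂-intro i₁ i₂ b c a i₁<i₂ i₂<b i₂<c i₂<a tc ta (v-flip a<c va≮vc)
           (exactly-oneˡ (∈D b<c (v-flip b<c vb≮vc)) (∉D-below (<⇒≤ a<b)))

  r₂-at-rows : ∀ i₁ i₂ → i₁ <ᶠ i₂ →
    ∑↑ 2 (suc (toℕ i₂)) v (λ s → ⟦ r₂-shape[i₃q₁] (comparisons (v i₁ ∷ v i₂ ∷ s)) ⟧)
    + ∑↑ 3 (suc (toℕ i₂)) v (λ s → r₂-shapes (comparisons (v i₁ ∷ v i₂ ∷ s)))
    ≤ ∑ n (λ i₃ → ∑ n λ j₁ → ∑ n λ j₂ → ⟦ R₂ i₁ i₂ i₃ j₁ j₂ ⟧)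
  r₂-at-rows i₁ i₂ i₁<i₂ = begin
    ∑↑ 2 lo v E + ∑↑ 3 lo v (λ s → I s + M s)
      ≡⟨ cong (∑↑ 2 lo v E +_) (∑↑-+ 3 lo v I M) ⟩
    ∑↑ 2 lo v E + (∑↑ 3 lo v I + ∑↑ 3 lo v M)
      ≤⟨ +-mono-≤ E-bound (+-mono-≤ I-bound M-bound) ⟩
    ∑ n (λ a → ∑ n λ b → ⟦ a <F b ⟧ * g a b a)
    + (∑ n (λ a → ∑ n λ b → ⟦ a <F b ⟧ * ∑ n λ c → ⟦ b <F c ⟧ * (g a b c + g a c b))
    +  ∑ n (λ a → ∑ n λ b → ⟦ a <F b ⟧ * ∑ n λ c → ⟦ b <F c ⟧ * (g b a c + g b c a)))
      ≤⟨ ∑-ordered-triples-≤ g ⟩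
    ∑ n (λ i₃ → ∑ n λ q₁ → ∑ n (g i₃ q₁))
      ≡⟨ ∑-cong (λ i₃ → trans (∑-permute (λ j₁ → ∑ n λ j₂ → ⟦ R₂ i₁ i₂ i₃ j₁ j₂ ⟧) w)
                             (∑-cong λ q₁ → ∑-permute (λ j₂ → ⟦ R₂ i₁ i₂ i₃ (w ⟨$⟩ʳ q₁) j₂ ⟧) w)) ⟨
    ∑ n (λ i₃ → ∑ n λ j₁ → ∑ n λ j₂ → ⟦ R₂ i₁ i₂ i₃ j₁ j₂ ⟧) ∎
    where
    open ≤-Reasoning
    lo : ℕ
    lo = suc (toℕ i₂)
    E I M : List ℕ → ℕ
    E s = ⟦ r₂-shape[i₃q₁] (comparisons (v i₁ ∷ v i₂ ∷ s)) ⟧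
    I s = ⟦ r₂-shape[i₃q₁q₂] (comparisons (v i₁ ∷ v i₂ ∷ s)) ⟧
        + ⟦ r₂-shape[i₃q₂q₁] (comparisons (v i₁ ∷ v i₂ ∷ s)) ⟧
    M s = ⟦ r₂-shape[q₁i₃q₂] (comparisons (v i₁ ∷ v i₂ ∷ s)) ⟧
        + ⟦ r₂-shape[q₂i₃q₁] (comparisons (v i₁ ∷ v i₂ ∷ s)) ⟧
    g : Fin n → Fin n → Fin n → ℕ
    g i₃ q₁ q₂ = ⟦ R₂ i₁ i₂ i₃ (w ⟨$⟩ʳ q₁) (w ⟨$⟩ʳ q₂) ⟧
    E-bound : ∑↑ 2 lo v E ≤ ∑ n (λ a → ∑ n λ b → ⟦ a <F b ⟧ * g a b a)
    E-bound = ∑-mono λ a → ⟦⟧*-≤ λ i₂<a → ∑-mono λ b → ⟦⟧*-mono λ a<b →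
      ⟦⟧-mono (R₂-i₃q₁ i₁ i₂ a b i₁<i₂ (T<F⇒<ᶠ i₂<a) (T<F⇒<ᶠ a<b))
    I-bound : ∑↑ 3 lo v I
            ≤ ∑ n (λ a → ∑ n λ b → ⟦ a <F b ⟧ * ∑ n λ c → ⟦ b <F c ⟧ * (g a b c + g a c b))
    I-bound = ∑-mono λ a → ⟦⟧*-≤ λ i₂<a → ∑-mono λ b → ⟦⟧*-mono λ a<b → ∑-mono λ c → ⟦⟧*-mono λ b<c →
      let open FivePositions i₁ i₂ a b c i₁<i₂ (T<F⇒<ᶠ i₂<a) (T<F⇒<ᶠ a<b) (T<F⇒<ᶠ b<c)
      in +-mono-≤ (⟦⟧-mono R₂-i₃q₁q₂) (⟦⟧-mono R₂-i₃q₂q₁)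
    M-bound : ∑↑ 3 lo v M
            ≤ ∑ n (λ a → ∑ n λ b → ⟦ a <F b ⟧ * ∑ n λ c → ⟦ b <F c ⟧ * (g b a c + g b c a))
    M-bound = ∑-mono λ a → ⟦⟧*-≤ λ i₂<a → ∑-mono λ b → ⟦⟧*-mono λ a<b → ∑-mono λ c → ⟦⟧*-mono λ b<c →
      let open FivePositions i₁ i₂ a b c i₁<i₂ (T<F⇒<ᶠ i₂<a) (T<F⇒<ᶠ a<b) (T<F⇒<ᶠ b<c)
      in +-mono-≤ (⟦⟧-mono R₂-q₁i₃q₂) (⟦⟧-mono R₂-q₂i₃q₁)

  r₂-bound : ∑↑ 4 0 v (⟦_⟧ ∘ r₂-shape[i₃q₁] ∘ comparisons) + ∑↑ 5 0 v (r₂-shapes ∘ comparisons) ≤ r₂ w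
  r₂-bound = ∑-guarded-+-≤ λ i₁ _ → ∑-guarded-+-≤ λ i₂ i₁<i₂ → r₂-at-rows i₁ i₂ (T<F⇒<ᶠ i₁<i₂)

  p₁₃₂-≤ : p (1 ∷ 3 ∷ 2 ∷ []) w ≤ ∑↑ 3 0 v (⟦_⟧ ∘ r₁-shape ∘ comparisons)
  p₁₃₂-≤ = ≤-trans (≤-reflexive (p≡∑↑ (1 ∷ 3 ∷ 2 ∷ []) w))
                   (counts-≤-shapes 3 v ((1 , 1 ∷ 3 ∷ 2 ∷ []) ∷ []) (⟦_⟧ ∘ r₁-shape) _)

  p₁₄₃₂-≤ : p (1 ∷ 4 ∷ 3 ∷ 2 ∷ []) w ≤ ∑↑ 4 0 v (⟦_⟧ ∘ r₂-shape[i₃q₁] ∘ comparisons)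
  p₁₄₃₂-≤ = ≤-trans (≤-reflexive (p≡∑↑ (1 ∷ 4 ∷ 3 ∷ 2 ∷ []) w))
                    (counts-≤-shapes 4 v ((1 , 1 ∷ 4 ∷ 3 ∷ 2 ∷ []) ∷ []) (⟦_⟧ ∘ r₂-shape[i₃q₁]) _)

  patterns₅-≤ : weighted 0 patterns₅ (λ u → p u w)
                ≤ ∑↑ 5 0 v (r₂-shapes ∘ comparisons) + ∑↑ 5 0 v (r₃-shapes ∘ comparisons)
  patterns₅-≤ = begin
    weighted 0 patterns₅ (λ u → p u w)
      -- every pattern in patterns₅ has length 5, so `length u` computes once `weighted` unfolds
      ≤⟨ weighted-mono patterns₅ {0} {0} ≤-refl (λ u → ≤-reflexive (p≡∑↑ u w)) ⟩
    weighted 0 patterns₅ (λ u → ∑↑ 5 0 v (λ s → ⟦ sameOrder u s ⟧))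
      ≡⟨ ∑↑-weighted 5 0 v patterns₅ (λ u s → ⟦ sameOrder u s ⟧) ⟩
    ∑↑ 5 0 v (λ s → weighted 0 patterns₅ (λ u → ⟦ sameOrder u s ⟧))
      ≤⟨ counts-≤-shapes 5 v patterns₅ (λ bs → r₂-shapes bs + r₃-shapes bs) _ ⟩
    ∑↑ 5 0 v (λ s → r₂-shapes (comparisons s) + r₃-shapes (comparisons s))
      ≡⟨ ∑↑-+ 5 0 v (r₂-shapes ∘ comparisons) (r₃-shapes ∘ comparisons) ⟩
    ∑↑ 5 0 v (r₂-shapes ∘ comparisons) + ∑↑ 5 0 v (r₃-shapes ∘ comparisons) ∎
    where open ≤-Reasoning

theorem4p1 : (n : ℕ) (w : Permutation′ n) →
    r₁ w + r₂ w + r₃ w ≥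
      p (1 ∷ 3 ∷ 2 ∷ []) w + p (1 ∷ 4 ∷ 3 ∷ 2 ∷ []) w
      + p (1 ∷ 3 ∷ 2 ∷ 5 ∷ 4 ∷ []) w + 3 * p (1 ∷ 4 ∷ 2 ∷ 5 ∷ 3 ∷ []) w
      + p (1 ∷ 4 ∷ 3 ∷ 5 ∷ 2 ∷ []) w + 4 * p (1 ∷ 5 ∷ 2 ∷ 4 ∷ 3 ∷ []) w
      + p (1 ∷ 5 ∷ 3 ∷ 2 ∷ 4 ∷ []) w + 2 * p (1 ∷ 5 ∷ 3 ∷ 4 ∷ 2 ∷ []) w
      + p (1 ∷ 5 ∷ 4 ∷ 3 ∷ 2 ∷ []) w + p (2 ∷ 4 ∷ 1 ∷ 5 ∷ 3 ∷ []) w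
      + 2 * p (2 ∷ 5 ∷ 1 ∷ 4 ∷ 3 ∷ []) w + p (3 ∷ 5 ∷ 1 ∷ 4 ∷ 2 ∷ []) w
theorem4p1 n w = begin
  weighted (p₁₃₂ + p₁₄₃₂) patterns₅ (λ u → p u w)
    ≡⟨ weighted-acc (p₁₃₂ + p₁₄₃₂) patterns₅ (λ u → p u w) ⟩
  p₁₃₂ + p₁₄₃₂ + weighted 0 patterns₅ (λ u → p u w)
    ≤⟨ +-mono-≤ (+-mono-≤ (≤-trans p₁₃₂-≤ r₁-bound) p₁₄₃₂-≤) patterns₅-≤ ⟩
  r₁ w + S₄ + (S₅ + S₅′)
    ≡⟨ +-assoc (r₁ w + S₄) S₅ S₅′ ⟨
  r₁ w + S₄ + S₅ + S₅′
    ≡⟨ cong (_+ S₅′) (+-assoc (r₁ w) S₄ S₅) ⟩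
  r₁ w + (S₄ + S₅) + S₅′
    ≤⟨ +-mono-≤ (+-monoʳ-≤ (r₁ w) r₂-bound) r₃-bound ⟩
  r₁ w + r₂ w + r₃ w ∎
  where
  open Rothe w
  open ≤-Reasoning
  p₁₃₂ p₁₄₃₂ S₄ S₅ S₅′ : ℕ
  p₁₃₂  = p (1 ∷ 3 ∷ 2 ∷ []) w
  p₁₄₃₂ = p (1 ∷ 4 ∷ 3 ∷ 2 ∷ []) w
  S₄    = ∑↑ 4 0 v (⟦_⟧ ∘ r₂-shape[i₃q₁] ∘ comparisons)
  S₅    = ∑↑ 5 0 v (r₂-shapes ∘ comparisons)
  S₅′   = ∑↑ 5 0 v (r₃-shapes ∘ comparisons)
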